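{- Let $r\ge2$, let $A\subseteq\mathbb{Z}/r\mathbb{Z}$ be nonempty, and suppose $(w_0,w_1,S_0)$ is a pointed minimal cover. Then (1) $\{\lnot P_{w_0}\}\cup\{P_s\}_{s\in S_0}$ is minimally inconsistent, and (2) $P_{w_1}<_0P_{w_0}$.
   Context: For $w\in\mathbb{Z}/r\mathbb{Z}$, $A+w=\{a+w\mid a\in A\}$. For a valuation $V\subseteq\mathbb{Z}/r\mathbb{Z}$, $P_w$ is true iff $A+w\subseteq V$; $\lnot P_w$ is its negation. The agenda is $\Gamma=\{P_w,\lnot P_w\}_{w\in\mathbb{Z}/r\mathbb{Z}}$. A subset of $\Gamma$ is consistent if some valuation $V\subseteq\mathbb{Z}/r\mathbb{Z}$ makes all its members true. $\Delta\subseteq\Gamma$ is minimally inconsistent if for all $\Delta_0\subseteq\Delta$, $\Delta_0$ is inconsistent iff $\Delta_0=\Delta$. For negation-free $\Phi,\Psi\in\Gamma$, $\Phi<_0\Psi$ means there is $\Gamma_0\subseteq\Gamma$ with $\Gamma_0\cup\{\Phi,\lnot\Psi\}$ minimally inconsistent and $\Gamma_0\cup\{\lnot\Phi,\Psi\}$ consistent. A triple $(w_0,w_1,S_0)$ with $w_0,w_1\in\mathbb{Z}/r\mathbb{Z}$, $S_0\subseteq\mathbb{Z}/r\mathbb{Z}$, $|S_0|\ge2$, $w_1\in S_0$ is a pointed minimal cover if (Minimality) for all $S_1\subseteq S_0$, $A+w_0\subseteq\bigcup_{s\in S_1}(A+s)$ iff $S_1=S_0$; and (Irreducibility) $A+w_1\not\subseteq\bigcup_{w\in(S_0\setminus\{w_1\})\cup\{w_0\}}(A+w)$.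 -}

module Defs where

open import Data.Nat using (ℕ; zero; suc; _+_)
open import Data.Nat.DivMod using (_mod_)
open import Data.Fin using (Fin; toℕ)
open import Data.Fin.Subset using (Subset; _∈_; _∉_; _⊆_; _∪_; _-_; ⁅_⁆)
open import Data.Product using (Σ; ∃; _×_)
open import Relation.Binary.PropositionalEquality using (_≡_)
open import Relation.Nullary using (¬_)
open import Function.Bundles using (_⇔_)

-- Addition in ℤ/rℤ, with ℤ/rℤ represented as Fin r (residues 0..r-1).
_⊕_ : ∀ {r} → Fin r → Fin r → Fin r
_⊕_ {suc n} i j = (toℕ i + toℕ j) mod suc n

module _ {r : ℕ} (A : Subset r) where

  InShift : Fin r → Fin r → Set
  InShift w x = ∃ λ a → a ∈ A × x ≡ a ⊕ w

  CoveredBy : Fin r → Subset r → Set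
  CoveredBy w S = ∀ x → InShift w x → ∃ λ s → s ∈ S × InShift s x

  -- truth of P_w under valuation V : A + w ⊆ V
  Holds : Subset r → Fin r → Set
  Holds V w = ∀ x → InShift w x → x ∈ V

  record PointedMinimalCover (w₀ w₁ : Fin r) (S₀ : Subset r) : Set where
    field
      size≥2          : 2 Data.Nat.≤ Data.Fin.Subset.∣ S₀ ∣
      w₁∈S₀           : w₁ ∈ S₀
      minimality      : ∀ S₁ → S₁ ⊆ S₀ → (CoveredBy w₀ S₁ ⇔ S₁ ≡ S₀)
      irreducibility  : ¬ CoveredBy w₁ ((S₀ - w₁) ∪ ⁅ w₀ ⁆)

-- A subset of the agenda Γ = {P_w, ¬P_w}: `pos` = the w with P_w ∈ Δ,
-- `neg` = the w with ¬P_w ∈ Δ.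
record AgendaSubset (r : ℕ) : Set where
  constructor ⟨_,_⟩
  field
    pos : Subset r
    neg : Subset r
open AgendaSubset public

_⊆Γ_ : ∀ {r} → AgendaSubset r → AgendaSubset r → Set
Δ ⊆Γ Δ′ = pos Δ ⊆ pos Δ′ × neg Δ ⊆ neg Δ′

_∪Γ_ : ∀ {r} → AgendaSubset r → AgendaSubset r → AgendaSubset r
Δ ∪Γ Δ′ = ⟨ pos Δ ∪ pos Δ′ , neg Δ ∪ neg Δ′ ⟩

module _ {r : ℕ} (A : Subset r) where

  Consistent : AgendaSubset r → Set
  Consistent Δ = ∃ λ (V : Subset r) →
    (∀ w → w ∈ pos Δ → Holds A V w) × (∀ w → w ∈ neg Δ → ¬ Holds A V w)

  MinimallyInconsistent : AgendaSubset r → Set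
  MinimallyInconsistent Δ = ∀ Δ₀ → Δ₀ ⊆Γ Δ → ((¬ Consistent Δ₀) ⇔ (Δ₀ ≡ Δ))

  Prec₀ : Fin r → Fin r → Set
  Prec₀ u v = ∃ λ (Γ₀ : AgendaSubset r) →
    MinimallyInconsistent (Γ₀ ∪Γ ⟨ ⁅ u ⁆ , ⁅ v ⁆ ⟩) ×
    Consistent (Γ₀ ∪Γ ⟨ ⁅ v ⁆ , ⁅ u ⁆ ⟩)

-- The valuation ⋃_{s ∈ S} (A + s) is the least one making every P_s true, so
-- {P_s}_{s ∈ S} ∪ {¬P_v}_{v ∈ N} is consistent iff no A + v with v ∈ N is covered
-- by the shifts A + s, s ∈ S.  Minimality of the cover S₀ of A + w₀ then makes
-- {¬P_{w₀}} ∪ {P_s}_{s ∈ S₀} minimally inconsistent.  For P_{w₁} <₀ P_{w₀} take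
-- Γ₀ = {P_s}_{s ∈ S₀ ∖ {w₁}}: the first agenda is the one just treated, and the
-- second, {P_s}_{s ∈ (S₀ ∖ {w₁}) ∪ {w₀}} ∪ {¬P_{w₁}}, is consistent by irreducibility.
module Submission where

open import Defs
open import Data.Nat using (ℕ; _≤_)
open import Data.Fin using (Fin)
open import Data.Fin.Subset using (Subset; Nonempty; ⁅_⁆)
open import Data.Product using (_×_)

import Data.Bool.Properties as Bool
open import Data.Fin using (_≟_)
open import Data.Fin.Properties using (any?)
open import Data.Fin.Subset using (⊥; _∈_; _⊆_; _∪_; _-_)
open import Data.Fin.Subset.Properties
  using (_∈?_; x∈⁅x⁆; x∈⁅y⁆⇒x≡y; ⊆-refl; ⊆-antisym; x∈p∪q⁺; x∈p∪q⁻; p─q⊆p;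
         x∈p∧x≢y⇒x∈p-y; ∪-identityˡ)
open import Data.Product using (_,_)
open import Data.Sum using (inj₁; inj₂)
open import Data.Vec using (tabulate)
open import Data.Vec.Properties using (lookup∘tabulate; []=⇒lookup; lookup⇒[]=; ≡-dec)
open import Function using (_∘_)
open import Function.Bundles using (_⇔_; mk⇔; Equivalence)
open import Relation.Binary.PropositionalEquality using (_≡_; refl; sym; trans; subst; cong₂)
open import Relation.Nullary using (Dec; yes; no; ¬_; contradiction)
open import Relation.Nullary.Decidable using (_×-dec_; isYes; toWitness; fromWitness; decidable-stable)
open import Relation.Unary using (Decidable)

module _ {n : ℕ} {P : Fin n → Set} (P? : Decidable P) where

  subsetOf : Subset n
  subsetOf = tabulate (isYes ∘ P?)

  ∈-subsetOf⁺ : ∀ {x} → P x → x ∈ subsetOf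
  ∈-subsetOf⁺ {x} px =
    lookup⇒[]= x subsetOf (trans (lookup∘tabulate _ x) (Equivalence.to Bool.T-≡ (fromWitness px)))

  ∈-subsetOf⁻ : ∀ {x} → x ∈ subsetOf → P x
  ∈-subsetOf⁻ {x} x∈ =
    toWitness (Equivalence.from Bool.T-≡ (trans (sym (lookup∘tabulate _ x)) ([]=⇒lookup x∈)))

p-x∪⁅x⁆≡p : ∀ {n} {x : Fin n} {p : Subset n} → x ∈ p → (p - x) ∪ ⁅ x ⁆ ≡ p
p-x∪⁅x⁆≡p {x = x} {p} x∈p = ⊆-antisym ⊆p p⊆
  where
  ⊆p : (p - x) ∪ ⁅ x ⁆ ⊆ p
  ⊆p y∈ with x∈p∪q⁻ (p - x) ⁅ x ⁆ y∈
  ... | inj₁ y∈p-x = p─q⊆p p ⁅ x ⁆ y∈p-x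
  ... | inj₂ y∈⁅x⁆ = subst (_∈ p) (sym (x∈⁅y⁆⇒x≡y x y∈⁅x⁆)) x∈p
  p⊆ : p ⊆ (p - x) ∪ ⁅ x ⁆
  p⊆ {y} y∈p with y ≟ x
  ... | yes refl = x∈p∪q⁺ (inj₂ (x∈⁅x⁆ y))
  ... | no y≢x = x∈p∪q⁺ (inj₁ (x∈p∧x≢y⇒x∈p-y y∈p y≢x))

p⊆⁅x⁆∧x∈p⇒p≡⁅x⁆ : ∀ {n} {x : Fin n} {p : Subset n} → p ⊆ ⁅ x ⁆ → x ∈ p → p ≡ ⁅ x ⁆
p⊆⁅x⁆∧x∈p⇒p≡⁅x⁆ {x = x} p⊆ x∈p =
  ⊆-antisym p⊆ (λ y∈⁅x⁆ → subst (_∈ _) (sym (x∈⁅y⁆⇒x≡y x y∈⁅x⁆)) x∈p)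

module _ {r : ℕ} (A : Subset r) where

  inShift? : ∀ w x → Dec (InShift A w x)
  inShift? w x = any? (λ a → (a ∈? A) ×-dec (x ≟ (a ⊕ w)))

  ⋃Shifts : Subset r → Subset r
  ⋃Shifts S = subsetOf (λ x → any? (λ s → (s ∈? S) ×-dec inShift? s x))

  holds-⋃Shifts : ∀ {S s} → s ∈ S → Holds A (⋃Shifts S) s
  holds-⋃Shifts s∈S x x∈A+s = ∈-subsetOf⁺ _ (_ , s∈S , x∈A+s)

  holds-⋃Shifts⇒coveredBy : ∀ {S w} → Holds A (⋃Shifts S) w → CoveredBy A w S
  holds-⋃Shifts⇒coveredBy holds x x∈A+w = ∈-subsetOf⁻ _ (holds x x∈A+w)

  coveredBy⇒holds : ∀ {S w V} → CoveredBy A w S → (∀ s → s ∈ S → Holds A V s) → Holds A V w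
  coveredBy⇒holds cover holdsS x x∈A+w with cover x x∈A+w
  ... | s , s∈S , x∈A+s = holdsS s s∈S x x∈A+s

  consistent⇔uncovered : ∀ {S N} → Consistent A ⟨ S , N ⟩ ⇔ (∀ v → v ∈ N → ¬ CoveredBy A v S)
  consistent⇔uncovered {S} = mk⇔
    (λ (V , holdsS , failsN) v v∈N cover → failsN v v∈N (coveredBy⇒holds cover holdsS))
    (λ uncovered → ⋃Shifts S , (λ _ → holds-⋃Shifts) ,
                   λ v v∈N → uncovered v v∈N ∘ holds-⋃Shifts⇒coveredBy)

  minimalCover⇒minimallyInconsistent : ∀ {w S} →
    (∀ S₁ → S₁ ⊆ S → (CoveredBy A w S₁ ⇔ S₁ ≡ S)) →
    MinimallyInconsistent A ⟨ S , ⁅ w ⁆ ⟩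
  minimalCover⇒minimallyInconsistent {w} {S} minimal ⟨ S₁ , N ⟩ (S₁⊆S , N⊆⁅w⁆) =
    mk⇔ inconsistent⇒whole whole⇒inconsistent
    where
    consistent : (∀ v → v ∈ N → ¬ CoveredBy A v S₁) → Consistent A ⟨ S₁ , N ⟩
    consistent = Equivalence.from consistent⇔uncovered

    uncovered⇒consistent : ¬ CoveredBy A w S₁ → Consistent A ⟨ S₁ , N ⟩
    uncovered⇒consistent ¬cover = consistent λ v v∈N →
      subst (λ v → ¬ CoveredBy A v S₁) (sym (x∈⁅y⁆⇒x≡y w (N⊆⁅w⁆ v∈N))) ¬cover

    inconsistent⇒whole : ¬ Consistent A ⟨ S₁ , N ⟩ → ⟨ S₁ , N ⟩ ≡ ⟨ S , ⁅ w ⁆ ⟩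
    inconsistent⇒whole inc with w ∈? N
    ... | no w∉N = contradiction (consistent λ v v∈N _ →
            w∉N (subst (_∈ N) (x∈⁅y⁆⇒x≡y w (N⊆⁅w⁆ v∈N)) v∈N)) inc
    ... | yes w∈N = cong₂ ⟨_,_⟩ S₁≡S (p⊆⁅x⁆∧x∈p⇒p≡⁅x⁆ N⊆⁅w⁆ w∈N)
      where
      S₁≡S : S₁ ≡ S
      S₁≡S = decidable-stable (≡-dec Bool._≟_ S₁ S) λ S₁≢S →
        inc (uncovered⇒consistent (S₁≢S ∘ Equivalence.to (minimal S₁ S₁⊆S)))

    whole⇒inconsistent : ⟨ S₁ , N ⟩ ≡ ⟨ S , ⁅ w ⁆ ⟩ → ¬ Consistent A ⟨ S₁ , N ⟩
    whole⇒inconsistent refl con = Equivalence.to consistent⇔uncovered con w (x∈⁅x⁆ w)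
      (Equivalence.from (minimal S ⊆-refl) refl)

lemma1 : (r : ℕ) → 2 ≤ r → (A : Subset r) → Nonempty A →
    (w₀ w₁ : Fin r) (S₀ : Subset r) → PointedMinimalCover A w₀ w₁ S₀ →
    MinimallyInconsistent A ⟨ S₀ , ⁅ w₀ ⁆ ⟩ × Prec₀ A w₁ w₀
lemma1 r _ A _ w₀ w₁ S₀ pmc = minimallyInconsistent , ⟨ S₀ - w₁ , ⊥ ⟩ , whole , consistent
  where
  open PointedMinimalCover pmc

  minimallyInconsistent : MinimallyInconsistent A ⟨ S₀ , ⁅ w₀ ⁆ ⟩
  minimallyInconsistent = minimalCover⇒minimallyInconsistent A minimality

  whole : MinimallyInconsistent A (⟨ S₀ - w₁ , ⊥ ⟩ ∪Γ ⟨ ⁅ w₁ ⁆ , ⁅ w₀ ⁆ ⟩)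
  whole = subst (MinimallyInconsistent A)
    (sym (cong₂ ⟨_,_⟩ (p-x∪⁅x⁆≡p w₁∈S₀) (∪-identityˡ ⁅ w₀ ⁆))) minimallyInconsistent

  consistent : Consistent A (⟨ S₀ - w₁ , ⊥ ⟩ ∪Γ ⟨ ⁅ w₀ ⁆ , ⁅ w₁ ⁆ ⟩)
  consistent = subst (λ N → Consistent A ⟨ (S₀ - w₁) ∪ ⁅ w₀ ⁆ , N ⟩) (sym (∪-identityˡ ⁅ w₁ ⁆))
    (Equivalence.from (consistent⇔uncovered A) λ v v∈⁅w₁⁆ →
      subst (λ v → ¬ CoveredBy A v _) (sym (x∈⁅y⁆⇒x≡y w₁ v∈⁅w₁⁆)) irreducibility)
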